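{- Let $\Gamma$ be a finite group containing an abelian subgroup of index $h$. Then for every integer $k\ge 3$, $$M_k'(\Gamma)\le h(k-1).$$
   Context: For a group $\Gamma$, a set $A\subseteq\Gamma$ is an $S_k'$-set if whenever $\alpha_1\beta_1^{ -1}\alpha_2\beta_2^{ -1}\cdots\alpha_k\beta_k^{ -1}=1$ with all $\alpha_i,\beta_i\in A$, there exists $i$ with $\alpha_i=\beta_i$ or $\beta_i=\alpha_{i+1}$ (indices cyclic, $\alpha_{k+1}=\alpha_1$). $M_k'(\Gamma)$ is the maximum size of an $S_k'$-set in $\Gamma$. -}

module Defs where

open import Level using (Level; _⊔_)
open import Data.Nat as ℕ using (ℕ; s≤s)
open import Data.Fin using (Fin; zero; suc; toℕ; fromℕ<)
open import Data.Product using (Σ; ∃; _×_; _,_)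
open import Data.Sum using (_⊎_)
open import Data.List using (List)
open import Relation.Nullary using (¬_; yes; no)
open import Relation.Unary using (Pred)
open import Relation.Binary.PropositionalEquality using (_≡_)
open import Algebra.Bundles using (Group)
import Data.List.Membership.Setoid as SetoidMembership

csuc : ∀ {n} → Fin n → Fin n
csuc {ℕ.suc m} i with ℕ.suc (toℕ i) ℕ.≤? m
... | yes p = fromℕ< (s≤s p)
... | no _  = zero

module GroupDefs {c ℓ} (G : Group c ℓ) where
  open Group G
  open SetoidMembership setoid public using (_∈_)

  IsFinite : Set (c ⊔ ℓ)
  IsFinite = Σ (List Carrier) λ xs → ∀ x → x ∈ xs

  record IsSubgroup {p} (H : Pred Carrier p) : Set (c ⊔ ℓ ⊔ p) where
    field
      resp   : ∀ {x y} → x ≈ y → H x → H y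
      ε-in   : H ε
      ∙-in   : ∀ {x y} → H x → H y → H (x ∙ y)
      ⁻¹-in  : ∀ {x} → H x → H (x ⁻¹)

  IsAbelianSubgroup : ∀ {p} (H : Pred Carrier p) → Set (c ⊔ ℓ ⊔ p)
  IsAbelianSubgroup H = IsSubgroup H × (∀ {x y} → H x → H y → (x ∙ y) ≈ (y ∙ x))

  -- H has index h: there is a left transversal of size h, i.e. elements
  -- r₀,…,r_{h-1} such that every g lies in some coset rᵢH, and the cosets
  -- rᵢH are pairwise distinct.
  HasIndex : ∀ {p} (H : Pred Carrier p) (h : ℕ) → Set (c ⊔ p)
  HasIndex H h = Σ (Fin h → Carrier) λ r →
      (∀ g → ∃ λ i → H ((r i) ⁻¹ ∙ g))
    × (∀ i j → H ((r i) ⁻¹ ∙ r j) → i ≡ j)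

  altProd : ∀ k → (Fin k → Carrier) → (Fin k → Carrier) → Carrier
  altProd ℕ.zero    α β = ε
  altProd (ℕ.suc k) α β = (α zero ∙ (β zero) ⁻¹) ∙ altProd k (λ i → α (suc i)) (λ i → β (suc i))

  IsS′Set : ℕ → List Carrier → Set (c ⊔ ℓ)
  IsS′Set k A = ∀ (α β : Fin k → Carrier) →
      (∀ i → α i ∈ A) → (∀ i → β i ∈ A) →
      altProd k α β ≈ ε →
      ∃ λ i → (α i ≈ β i) ⊎ (β i ≈ α (csuc i))

{-# OPTIONS --safe #-}
-- An S′ₖ-set A meets every left coset rH in at most k − 1 elements; as the h
-- cosets rᵢH cover Γ, this gives |A| ≤ h(k − 1). Suppose a₀, …, a_{k−1} are
-- distinct elements of A in rH and put αᵢ = aᵢ, βᵢ = a_{i−1} (indices mod k).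
-- Quotients x y⁻¹ of elements of rH lie in the abelian group rHr⁻¹, so the
-- product (a₀ a_{k−1}⁻¹)(a₁ a₀⁻¹)⋯(a_{k−1} a_{k−2}⁻¹) telescopes to 1. Since
-- the aᵢ are distinct and k ≥ 3, neither αᵢ = βᵢ nor βᵢ = αᵢ₊₁ can hold.
module Submission where

open import Defs
open import Data.Nat using (ℕ; zero; suc; _≤_; _*_; _∸_; _+_; z≤n; s≤s; s≤s⁻¹; _≤?_)
open import Data.Nat.Properties
  using (1+n≢n; 0≢1+n; m≢1+n+m; suc-injective; +-suc; +-mono-≤; ≤-trans; ≤-antisym; ≮⇒≥; module ≤-Reasoning)
open import Data.Fin using (Fin; zero; suc; toℕ; fromℕ; inject₁; inject≤; _≟_)
open import Data.Fin.Properties using (toℕ-fromℕ<; toℕ-inject₁; toℕ<n; inject≤-injective)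
open import Data.List using (List; []; _∷_; length; lookup; filter)
import Data.List.Relation.Unary.All as All
open import Data.List.Relation.Unary.All using (All; []; _∷_)
open import Data.List.Relation.Unary.All.Properties using (all-filter; filter⁺)
open import Data.List.Relation.Unary.AllPairs using (AllPairs; _∷_)
import Data.List.Relation.Unary.AllPairs.Properties as AllPairs
open import Data.List.Relation.Binary.Sublist.Propositional using (_⊆_)
import Data.List.Relation.Binary.Sublist.Propositional.Properties as Sublist
open import Data.List.Membership.Propositional.Properties using (∈-lookup)
import Data.List.Relation.Unary.Unique.Setoid as UniqueSetoid
open import Data.Product using (∃; _×_; _,_; proj₁; proj₂)
open import Data.Sum using (_⊎_; inj₁; inj₂)
open import Data.Bool using (true; false)
open import Data.Empty using (⊥; ⊥-elim)
open import Function using (_∘_; id)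
open import Relation.Nullary using (¬_; yes; no; does)
open import Relation.Unary using (Pred; Decidable)
open import Relation.Unary.Properties using (∁?)
import Relation.Binary.PropositionalEquality as ≡
open ≡ using (_≡_; _≢_; cong)
open import Relation.Binary.Bundles using (Setoid)
open import Algebra.Bundles using (Group)

cpred : ∀ {m} → Fin (suc m) → Fin (suc m)
cpred zero    = fromℕ _
cpred (suc i) = inject₁ i

toℕ-csuc : ∀ {m} (i : Fin (suc m)) →
           toℕ (csuc i) ≡ suc (toℕ i) ⊎ (toℕ (csuc i) ≡ 0 × toℕ i ≡ m)
toℕ-csuc {m} i with suc (toℕ i) ≤? m
... | yes i+1≤m = inj₁ (toℕ-fromℕ< (s≤s i+1≤m))
... | no  i+1≰m = inj₂ (≡.refl , ≤-antisym (s≤s⁻¹ (toℕ<n i)) (≮⇒≥ i+1≰m))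

cpred≢id : ∀ {m} (i : Fin (2 + m)) → cpred i ≢ i
cpred≢id zero    ()
cpred≢id (suc i) eq = 1+n≢n (≡.sym (≡.trans (≡.sym (toℕ-inject₁ i)) (cong toℕ eq)))

cpred≢csuc : ∀ {m} (i : Fin (3 + m)) → cpred i ≢ csuc i
-- For i = zero both sides compute: csuc zero is suc zero because 1 ≤ 2 + m holds by evaluation.
cpred≢csuc zero    ()
cpred≢csuc (suc i) eq with toℕ-csuc (suc i) | ≡.trans (≡.sym (toℕ-inject₁ i)) (cong toℕ eq)
... | inj₁ next          | i≡csuc = m≢1+n+m (toℕ i) (≡.trans i≡csuc next)
... | inj₂ (wrap , last) | i≡csuc = 0≢1+n (≡.trans (≡.sym wrap) (≡.trans (≡.sym i≡csuc) (suc-injective last)))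

module _ {a p} {X : Set a} {P : Pred X p} (P? : Decidable P) where

  length-filter+length-filter-∁ : ∀ xs → length (filter P? xs) + length (filter (∁? P?) xs) ≡ length xs
  length-filter+length-filter-∁ []       = ≡.refl
  length-filter+length-filter-∁ (x ∷ xs) with ih ← length-filter+length-filter-∁ xs | does (P? x)
  ... | true  = cong suc ih
  ... | false = ≡.trans (+-suc _ _) (cong suc ih)

module _ {a} {X : Set a} where

  covered-length≤h*m : ∀ {p h m} {P : Fin h → Pred X p} (P? : ∀ i → Decidable (P i)) {xs : List X} →
                       All (λ x → ∃ λ i → P i x) xs → (∀ i → length (filter (P? i) xs) ≤ m) →
                       length xs ≤ h * m
  covered-length≤h*m {h = zero}  P? []              _      = z≤n
  covered-length≤h*m {h = zero}  P? ((() , _) ∷ _) _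
  covered-length≤h*m {h = suc h} {m} {P} P? {xs} covered fibre≤ = begin
    length xs                                     ≡⟨ ≡.sym (length-filter+length-filter-∁ (P? zero) xs) ⟩
    length (filter (P? zero) xs) + length rest    ≤⟨ +-mono-≤ (fibre≤ zero) (covered-length≤h*m (λ i → P? (suc i)) rest-covered rest-fibre≤) ⟩
    m + h * m                                     ∎
    where
    open ≤-Reasoning
    rest : List X
    rest = filter (∁? (P? zero)) xs

    rest-covered : All (λ x → ∃ λ i → P (suc i) x) rest
    rest-covered = All.zipWith shift (all-filter (∁? (P? zero)) xs , filter⁺ (∁? (P? zero)) covered)
      where
      shift : ∀ {x} → ¬ P zero x × ∃ (λ i → P i x) → ∃ λ i → P (suc i) x
      shift (¬P₀x , zero  , P₀x) = ⊥-elim (¬P₀x P₀x)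
      shift (_    , suc i , Pᵢx) = i , Pᵢx

    rest-fibre≤ : ∀ i → length (filter (P? (suc i)) rest) ≤ m
    rest-fibre≤ i = ≤-trans (Sublist.length-mono-≤ fibre-of-rest⊆fibre) (fibre≤ (suc i))
      where
      fibre-of-rest⊆fibre : filter (P? (suc i)) rest ⊆ filter (P? (suc i)) xs
      fibre-of-rest⊆fibre = Sublist.filter⁺ (P? (suc i)) (P? (suc i)) (λ { ≡.refl → id }) (Sublist.filter-⊆ _ xs)

module _ {a ℓ} (S : Setoid a ℓ) where
  open Setoid S
  open UniqueSetoid S using (Unique)

  lookup-injective : ∀ {xs} → Unique xs → ∀ {i j} → lookup xs i ≈ lookup xs j → i ≡ j
  lookup-injective (_   ∷ _) {zero}  {zero}  _   = ≡.refl
  lookup-injective (x≉ ∷ _) {zero}  {suc j} x≈  = ⊥-elim (All.lookup x≉ (∈-lookup j) x≈)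
  lookup-injective (x≉ ∷ _) {suc i} {zero}  ≈x  = ⊥-elim (All.lookup x≉ (∈-lookup i) (sym ≈x))
  lookup-injective (_   ∷ u) {suc i} {suc j} eq  = cong suc (lookup-injective u eq)

module _ {c ℓ} (G : Group c ℓ) where
  open Group G
  open GroupDefs G
  open UniqueSetoid setoid using (Unique)
  open import Algebra.Properties.Group G using (\\-leftDividesˡ; \\-leftDividesʳ; //-rightDividesˡ; ⁻¹-anti-homo-∙)
  open import Relation.Binary.Reasoning.Setoid setoid

  //-telescope : ∀ x y z → (x // y) ∙ (y // z) ≈ x // z
  //-telescope x y z = trans (assoc x (y ⁻¹) (y // z)) (∙-congˡ (\\-leftDividesʳ y (z ⁻¹)))

  conj : Carrier → Carrier → Carrier
  conj r x = r ∙ x ∙ r ⁻¹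

  conj-cong : ∀ r {x y} → x ≈ y → conj r x ≈ conj r y
  conj-cong r x≈y = ∙-congʳ (∙-congˡ x≈y)

  conj-∙ : ∀ r x y → conj r x ∙ conj r y ≈ conj r (x ∙ y)
  conj-∙ r x y = begin
    conj r x ∙ (r ∙ y ∙ r ⁻¹)   ≈⟨ assoc (conj r x) (r ∙ y) (r ⁻¹) ⟨
    conj r x ∙ (r ∙ y) ∙ r ⁻¹   ≈⟨ ∙-congʳ (assoc (conj r x) r y) ⟨
    conj r x ∙ r ∙ y ∙ r ⁻¹     ≈⟨ ∙-congʳ (∙-congʳ (//-rightDividesˡ r (r ∙ x))) ⟩
    r ∙ x ∙ y ∙ r ⁻¹            ≈⟨ ∙-congʳ (assoc r x y) ⟩
    r ∙ (x ∙ y) ∙ r ⁻¹          ∎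

  //-conj : ∀ r x y → x // y ≈ conj r ((r \\ x) // (r \\ y))
  //-conj r x y = sym (begin
    r ∙ ((r \\ x) ∙ (r \\ y) ⁻¹) ∙ r ⁻¹   ≈⟨ ∙-congʳ (assoc r (r \\ x) ((r \\ y) ⁻¹)) ⟨
    r ∙ (r \\ x) ∙ (r \\ y) ⁻¹ ∙ r ⁻¹     ≈⟨ ∙-congʳ (∙-congʳ (\\-leftDividesˡ r x)) ⟩
    x ∙ (r \\ y) ⁻¹ ∙ r ⁻¹                ≈⟨ assoc x ((r \\ y) ⁻¹) (r ⁻¹) ⟩
    x ∙ ((r \\ y) ⁻¹ ∙ r ⁻¹)              ≈⟨ ∙-congˡ (⁻¹-anti-homo-∙ r (r \\ y)) ⟨
    x ∙ (r ∙ (r \\ y)) ⁻¹                 ≈⟨ ∙-congˡ (⁻¹-cong (\\-leftDividesˡ r y)) ⟩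
    x ∙ y ⁻¹                              ∎)

  module _ {p} {H : Pred Carrier p} (H-abelian : IsAbelianSubgroup H) where
    open IsSubgroup (proj₁ H-abelian) using (∙-in; ⁻¹-in)

    Coset : Carrier → Pred Carrier p
    Coset r x = H (r \\ x)

    -- x // y is the conjugate by r of (r \\ x) // (r \\ y) ∈ H, so these
    -- quotients all lie in the abelian subgroup rHr⁻¹.
    coset-//-comm : ∀ {r x y z w} → Coset r x → Coset r y → Coset r z → Coset r w →
                    (x // y) ∙ (z // w) ≈ (z // w) ∙ (x // y)
    coset-//-comm {r} {x} {y} {z} {w} x∈rH y∈rH z∈rH w∈rH = begin
      (x // y) ∙ (z // w)     ≈⟨ ∙-cong (//-conj r x y) (//-conj r z w) ⟩
      conj r u ∙ conj r v     ≈⟨ conj-∙ r u v ⟩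
      conj r (u ∙ v)          ≈⟨ conj-cong r (proj₂ H-abelian u∈H v∈H) ⟩
      conj r (v ∙ u)          ≈⟨ conj-∙ r v u ⟨
      conj r v ∙ conj r u     ≈⟨ ∙-cong (//-conj r z w) (//-conj r x y) ⟨
      (z // w) ∙ (x // y)     ∎
      where
      u v : Carrier
      u = (r \\ x) // (r \\ y)
      v = (r \\ z) // (r \\ w)
      u∈H : H u
      u∈H = ∙-in x∈rH (⁻¹-in y∈rH)
      v∈H : H v
      v∈H = ∙-in z∈rH (⁻¹-in w∈rH)

    altProd-telescope : ∀ {r} n (c : Fin (suc n) → Carrier) → (∀ j → Coset r (c j)) →
                        altProd n (λ j → c (suc j)) (c ∘ inject₁) ≈ c (fromℕ n) // c zero
    altProd-telescope zero    c _    = sym (inverseʳ (c zero))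
    altProd-telescope (suc n) c c∈rH = begin
      (c (suc zero) // c zero) ∙ altProd n (λ j → c (suc (suc j))) (λ j → c (suc (inject₁ j)))
        ≈⟨ ∙-congˡ (altProd-telescope n (λ j → c (suc j)) (λ j → c∈rH (suc j))) ⟩
      (c (suc zero) // c zero) ∙ (c (fromℕ (suc n)) // c (suc zero))
        ≈⟨ coset-//-comm (c∈rH _) (c∈rH _) (c∈rH _) (c∈rH _) ⟩
      (c (fromℕ (suc n)) // c (suc zero)) ∙ (c (suc zero) // c zero)
        ≈⟨ //-telescope _ _ _ ⟩
      c (fromℕ (suc n)) // c zero ∎

    altProd-cpred≈ε : ∀ {r m} (c : Fin (suc m) → Carrier) → (∀ j → Coset r (c j)) →
                      altProd (suc m) c (c ∘ cpred) ≈ ε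
    altProd-cpred≈ε {m = m} c c∈rH = begin
      (c zero // c (fromℕ m)) ∙ altProd m (λ j → c (suc j)) (c ∘ inject₁)  ≈⟨ ∙-congˡ (altProd-telescope m c c∈rH) ⟩
      (c zero // c (fromℕ m)) ∙ (c (fromℕ m) // c zero)                     ≈⟨ //-telescope _ _ _ ⟩
      c zero // c zero                                                       ≈⟨ inverseʳ (c zero) ⟩
      ε                                                                      ∎

    injective-coset-family⇒¬S′ : ∀ {r n A} (a : Fin (3 + n) → Carrier) → (∀ {i j} → a i ≈ a j → i ≡ j) →
                                 (∀ i → a i ∈ A) → (∀ i → Coset r (a i)) → ¬ IsS′Set (3 + n) A
    injective-coset-family⇒¬S′ a a-injective a∈A a∈rH S′
      with S′ a (a ∘ cpred) a∈A (a∈A ∘ cpred) (altProd-cpred≈ε a a∈rH)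
    ... | i , inj₁ aᵢ≈aᵢ₋₁   = cpred≢id i (≡.sym (a-injective aᵢ≈aᵢ₋₁))
    ... | i , inj₂ aᵢ₋₁≈aᵢ₊₁ = cpred≢csuc i (a-injective aᵢ₋₁≈aᵢ₊₁)

    coset-length≤ : ∀ {r n A} (ys : List Carrier) → Unique ys →
                    All (_∈ A) ys → All (Coset r) ys → IsS′Set (3 + n) A → length ys ≤ 2 + n
    coset-length≤ {n = n} ys distinct ys⊆A ys⊆rH S′ = ≮⇒≥ long⇒¬S′
      where
      long⇒¬S′ : 3 + n ≤ length ys → ⊥
      long⇒¬S′ k≤len = injective-coset-family⇒¬S′ a a-injective
                         (λ _ → All.lookup ys⊆A (∈-lookup _)) (λ _ → All.lookup ys⊆rH (∈-lookup _)) S′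
        where
        a : Fin (3 + n) → Carrier
        a i = lookup ys (inject≤ i k≤len)
        a-injective : ∀ {i j} → a i ≈ a j → i ≡ j
        a-injective eq = inject≤-injective _ _ _ _ (lookup-injective setoid distinct eq)

proposition6p5 : ∀ {c ℓ p} (G : Group c ℓ) → GroupDefs.IsFinite G →
    (H : Pred (Group.Carrier G) p) → GroupDefs.IsAbelianSubgroup G H →
    (h : ℕ) → GroupDefs.HasIndex G H h →
    (k : ℕ) → 3 ≤ k →
    (A : List (Group.Carrier G)) → AllPairs (λ x y → ¬ Group._≈_ G x y) A →
    GroupDefs.IsS′Set G k A →
    length A ≤ h * (k ∸ 1)
proposition6p5 G _ H H-abelian h (r , cover , _) (suc (suc (suc n))) (s≤s (s≤s (s≤s z≤n))) A distinct S′ =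
  covered-length≤h*m fibre? (All.universal (λ x → f x , ≡.refl) A) fibre-length≤
  where
  open Group G using (Carrier; setoid)

  f : Carrier → Fin h
  f x = proj₁ (cover x)

  fibre? : ∀ i → Decidable (λ x → f x ≡ i)
  fibre? i x = f x ≟ i

  fibre⊆coset : ∀ i → All (Coset G H-abelian (r i)) (filter (fibre? i) A)
  fibre⊆coset i = All.map (λ {x} fx≡i → ≡.subst (λ j → Coset G H-abelian (r j) x) fx≡i (proj₂ (cover x)))
                          (all-filter (fibre? i) A)

  fibre-length≤ : ∀ i → length (filter (fibre? i) A) ≤ 2 + n
  fibre-length≤ i = coset-length≤ G H-abelian (filter (fibre? i) A) (AllPairs.filter⁺ (fibre? i) distinct)
                      (filter⁺ (fibre? i) (All.tabulateₛ setoid id)) (fibre⊆coset i) S′
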